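{- Let $n\ge k\ge 3$ be integers and let $\mathcal{F}$ be a family of subsets of $[n]$ containing neither a copy of $Y_k$ nor a copy of $Y'_k$ on consecutive levels. Let $\sigma$ be a cyclic permutation of $[n]$, and for $0\le i\le n$ let $x_i$ be the number of intervals of size $i$ along $\sigma$ that belong to $\mathcal{F}$. If $x_0 = 1$ and $x_1 + x_2 + \cdots +x_{k} = (k-1)n$, then $x_0 + x_1 + \cdots + x_{k-1} \le (k-1)n - \lfloor n/2\rfloor$. If $x_n = 1$ and $x_{n-k} + x_{n-k+1} + \cdots +x_{n-1} = (k-1)n$, then $x_{n-k+1} + x_{n-k+2} + \cdots + x_{n} \le (k-1)n - \lfloor n/2\rfloor$.
   Context: A family $\mathcal{F}$ of subsets of $[n]$ contains a copy of $Y_k$ on consecutive levels if it contains $k+1$ distinct sets $F_1, F_2, G_1, \ldots, G_{k-1}$ with $G_1\subset \cdots \subset G_{k-1} \subset F_1$, $G_{k-1}\subset F_2$, and $|F_1| = |F_2| = |G_{k-1}|+1 = \cdots = |G_1|+k-1$; it contains a copy of $Y'_k$ on consecutive levels if it contains $k+1$ distinct sets with $G_1\supset\cdots\supset G_{k-1}\supset F_1$, $G_{k-1}\supset F_2$, and $|F_1|=|F_2|=|G_{k-1}|-1=\cdots=|G_1|-(k-1)$. A cyclic permutation $\sigma$ of $[n]$ is a cyclic ordering $a_1,\ldots,a_n,a_1$ of $[n]$; an interval along $\sigma$ is a set $\{a_{t+1},\ldots,a_{t+s}\}$ (indices modulo $n$), $0\le s\le n$; in particular $\emptyset$ and $[n]$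 are the unique intervals of sizes $0$ and $n$, and there are $n$ intervals of each size $1\le s\le n-1$. -}

module Defs where

open import Data.Nat using (ℕ; zero; suc; _+_; _*_; _∸_; _≤_; _<_; _≤ᵇ_; _<ᵇ_)
open import Data.Bool using (Bool; true; false; T; if_then_else_)
open import Data.Fin using (Fin; toℕ)
open import Data.Fin.Subset using (Subset; _⊂_; ∣_∣)
open import Data.Vec.Properties using (≡-dec)
import Data.Bool.Properties as BoolP
open import Data.Fin.Permutation using (Permutation′; _⟨$⟩ˡ_)
open import Data.Vec using (tabulate)
open import Data.List using (List; length; filter; map; deduplicate; allFin)
open import Data.Product using (∃; ∃-syntax; _×_)
open import Relation.Binary.PropositionalEquality using (_≡_; _≢_)
open import Relation.Nullary.Decidable using (T?)

Family : ℕ → Set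
Family n = Subset n → Bool

_∈𝓕_ : ∀ {n} → Subset n → Family n → Set
S ∈𝓕 𝓕 = T (𝓕 S)

ContainsY : ∀ {n} → ℕ → Family n → Set
ContainsY {n} k 𝓕 =
  ∃ λ (F₁ : Subset n) → ∃ λ (F₂ : Subset n) → ∃ λ (G : ℕ → Subset n) →
    ( F₁ ∈𝓕 𝓕 × F₂ ∈𝓕 𝓕 × (∀ i → 1 ≤ i → i ≤ k ∸ 1 → G i ∈𝓕 𝓕)
    × F₁ ≢ F₂
    × (∀ i → 1 ≤ i → i ≤ k ∸ 1 → F₁ ≢ G i × F₂ ≢ G i)
    × (∀ i j → 1 ≤ i → i < j → j ≤ k ∸ 1 → G i ≢ G j)
    × (∀ i → 1 ≤ i → i < k ∸ 1 → G i ⊂ G (suc i))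
    × G (k ∸ 1) ⊂ F₁ × G (k ∸ 1) ⊂ F₂
    × ∣ F₁ ∣ ≡ ∣ F₂ ∣
    × (∀ i → 1 ≤ i → i ≤ k ∸ 1 → ∣ G i ∣ + (k ∸ i) ≡ ∣ F₁ ∣))

ContainsY' : ∀ {n} → ℕ → Family n → Set
ContainsY' {n} k 𝓕 =
  ∃ λ (F₁ : Subset n) → ∃ λ (F₂ : Subset n) → ∃ λ (G : ℕ → Subset n) →
    ( F₁ ∈𝓕 𝓕 × F₂ ∈𝓕 𝓕 × (∀ i → 1 ≤ i → i ≤ k ∸ 1 → G i ∈𝓕 𝓕)
    × F₁ ≢ F₂
    × (∀ i → 1 ≤ i → i ≤ k ∸ 1 → F₁ ≢ G i × F₂ ≢ G i)
    × (∀ i j → 1 ≤ i → i < j → j ≤ k ∸ 1 → G i ≢ G j)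
    × (∀ i → 1 ≤ i → i < k ∸ 1 → G (suc i) ⊂ G i)
    × F₁ ⊂ G (k ∸ 1) × F₂ ⊂ G (k ∸ 1)
    × ∣ F₁ ∣ ≡ ∣ F₂ ∣
    × (∀ i → 1 ≤ i → i ≤ k ∸ 1 → ∣ F₁ ∣ + (k ∸ i) ≡ ∣ G i ∣))

-- A cyclic permutation is represented by a linear ordering a₁,…,aₙ
-- (a_{p+1} = σ ⟨$⟩ʳ p for p : Fin n), read cyclically.
-- interval σ t s = {a_{t+1}, …, a_{t+s}} (indices mod n), for t : Fin n.
interval : ∀ {n} → Permutation′ n → Fin n → ℕ → Subset n
interval {n} σ t s = tabulate λ j →
  let p = toℕ (σ ⟨$⟩ˡ j)
      off = if toℕ t ≤ᵇ p then p ∸ toℕ t else p + n ∸ toℕ t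
  in off <ᵇ s

intervalsOfSize : ∀ {n} → Permutation′ n → ℕ → List (Subset n)
intervalsOfSize σ s = deduplicate (≡-dec BoolP._≟_) (map (λ t → interval σ t s) (allFin _))

xCount : ∀ {n} → Family n → Permutation′ n → ℕ → ℕ
xCount 𝓕 σ i = length (filter (λ S → T? (𝓕 S)) (intervalsOfSize σ i))

sumRange : (ℕ → ℕ) → ℕ → ℕ → ℕ
sumRange f a zero = 0
sumRange f a (suc m) = f a + sumRange f (suc a) m

-- Say that length i is missing at position t of σ if the interval of length i starting at t
-- is not in 𝓕, and let S count the missing pairs (t, i) with 1 ≤ i ≤ k-1, so that
-- x₁ + ⋯ + x_{k-1} ≤ (k-1)n - S.  If no length is missing at t+1 while the interval of length
-- k-1 at t is in 𝓕, then ∅ and the intervals of lengths 1, …, k-2 at t+1, topped by the two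
-- intervals of length k-1 at t and t+1, form a Y_k.  So some length is missing at t or t+1,
-- and 2S ≥ n.  The hypothesis on x₁ + ⋯ + x_k gives x_k ≥ S > 0, and an interval of length k
-- at some t excludes 2S = n: then positions with nothing missing alternate with positions
-- missing only length k-1, so for the full one u among t, t+1, the interval of length k at t,
-- the intervals of lengths k-1, …, 2 at u and the singletons at u and u+1 form a Y'_k.  Hence
-- S > ⌊n/2⌋.  Taking complements exchanges Y_k with Y'_k and intervals of size i with
-- intervals of size n-i, which turns the second statement into the first.

module Submission where

open import Defs
open import Data.Nat.Properties
open import Algebra.Properties.CommutativeMonoid.Sum +-0-commutativeMonoid
  using (sum; sum-syntax; sum-remove; sum-init-last; sum-cong-≗; sum-replicate-zero; ∑-distrib-+)
open import Algebra.Properties.CommutativeSemigroup +-commutativeSemigroup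
  using (interchange)
open import Data.Bool using (Bool; true; false; T; not; if_then_else_)
open import Data.Bool.Properties using (T-≡)
open import Data.Empty using (⊥-elim)
open import Data.Fin as Fin using (Fin; toℕ; fromℕ; fromℕ<; inject₁)
open import Data.Fin.Permutation using (Permutation′; _⟨$⟩ʳ_; _⟨$⟩ˡ_; inverseˡ; inverseʳ)
open import Data.Fin.Properties
  using (any?; punchInᵢ≢i; toℕ-injective; toℕ<n; toℕ-fromℕ<; toℕ-fromℕ; toℕ-inject₁)
open import Data.Fin.Subset using (Subset; _⊆_; _⊂_; _∈_; ∣_∣; ∁)
open import Data.Fin.Subset.Properties
  using (_∈?_; ⊆-antisym; ∣p∣≤n; ∣∁p∣≡n∸∣p∣; p⊂q⇒∁p⊃∁q; ∪-∩-booleanAlgebra)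
import Algebra.Lattice.Properties.BooleanAlgebra as BooleanAlgebraProperties
open import Data.List as List using (length; filter; deduplicate)
open import Data.List.Properties using (map-tabulate)
import Data.List.Relation.Binary.Sublist.Propositional as Sublist
open import Data.List.Relation.Binary.Sublist.Propositional.Properties
  using (filter-⊆; filter⁺; length-mono-≤)
open import Data.Nat
  using (ℕ; zero; suc; pred; _+_; _*_; _∸_; _/_; _≤_; _<_; _≤ᵇ_; _<ᵇ_; z≤n; s≤s; s≤s⁻¹; z<s)
open import Data.Nat.DivMod using (m<n*o⇒m/o<n)
open import Data.Product using (∃; _×_; _,_; proj₁; proj₂)
open import Data.Sum using (_⊎_; inj₁; inj₂)
open import Data.Vec using (tabulate)
open import Data.Vec.Functional using (removeAt)
open import Data.Vec.Properties
  using (tabulate-cong; tabulate-∘; lookup∘tabulate; []=⇒lookup; lookup⇒[]=)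
open import Function using (id; _∘_; _⇔_; mk⇔; Equivalence)
open import Level using (0ℓ)
open import Relation.Binary using (Rel; Decidable)
open import Relation.Binary.PropositionalEquality
open import Relation.Nullary using (¬_; yes; no; ¬?; contradiction)
open import Relation.Nullary.Decidable using (T?; decidable-stable; _×-dec_)
open import Relation.Nullary.Reflects using (ofʸ; ofⁿ)

private variable n : ℕ

indicator : Bool → ℕ
indicator true  = 1
indicator false = 0

deduplicate-⊆ : ∀ {A : Set} {R : Rel A 0ℓ} (R? : Decidable R) xs → deduplicate R? xs Sublist.⊆ xs
deduplicate-⊆ R? List.[]       = Sublist.[]
deduplicate-⊆ R? (x List.∷ xs) = refl Sublist.∷ Sublist.⊆-trans (filter-⊆ _ _) (deduplicate-⊆ R? xs)

length-filter-tabulate : ∀ {n} {A : Set} (b : A → Bool) (g : Fin n → A) →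
  length (filter (λ a → T? (b a)) (List.tabulate g)) ≡ ∑[ t < n ] indicator (b (g t))
length-filter-tabulate {zero}  b g = refl
length-filter-tabulate {suc n} b g with b (g Fin.zero)
... | true  = cong suc (length-filter-tabulate b (λ t → g (Fin.suc t)))
... | false = length-filter-tabulate b (λ t → g (Fin.suc t))

xCount≤∑ : ∀ {n} (𝓕 : Family n) (σ : Permutation′ n) i →
  xCount 𝓕 σ i ≤ ∑[ t < n ] indicator (𝓕 (interval σ t i))
xCount≤∑ {n} 𝓕 σ i = begin
  length (filter P? (deduplicate _ (List.map I (List.allFin n))))
    ≤⟨ length-mono-≤ (filter⁺ P? P? (λ { refl p → p }) (deduplicate-⊆ _ (List.map I (List.allFin n)))) ⟩
  length (filter P? (List.map I (List.allFin n)))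
    ≡⟨ cong (length ∘ filter P?) (map-tabulate id I) ⟩
  length (filter P? (List.tabulate I))
    ≡⟨ length-filter-tabulate 𝓕 I ⟩
  ∑[ t < n ] indicator (𝓕 (I t))
    ∎
  where
  open ≤-Reasoning
  P? = λ S → T? (𝓕 S)
  I = λ t → interval σ t i

∑-const : ∀ n c → ∑[ t < n ] c ≡ n * c
∑-const zero    c = refl
∑-const (suc n) c = cong (c +_) (∑-const n c)

∑-mono-≤ : ∀ {n} {f g : Fin n → ℕ} → (∀ t → f t ≤ g t) → sum f ≤ sum g
∑-mono-≤ {zero}  f≤g = z≤n
∑-mono-≤ {suc n} f≤g = +-mono-≤ (f≤g Fin.zero) (∑-mono-≤ (f≤g ∘ Fin.suc))

∑-positive : ∀ {n} {f : Fin n → ℕ} → (∀ t → 1 ≤ f t) → n ≤ sum f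
∑-positive {n} {f} 1≤f = begin
  n               ≡⟨ sym (*-identityʳ n) ⟩
  n * 1           ≡⟨ sym (∑-const n 1) ⟩
  ∑[ t < n ] 1    ≤⟨ ∑-mono-≤ 1≤f ⟩
  sum f           ∎
  where open ≤-Reasoning

∑-positive-tight : ∀ {n} {f : Fin n → ℕ} → (∀ t → 1 ≤ f t) → sum f ≤ n → ∀ t → f t ≤ 1
∑-positive-tight {suc n} {f} 1≤f ∑f≤n t = +-cancelʳ-≤ n (f t) 1 (begin
  f t + n                 ≤⟨ +-monoʳ-≤ (f t) (∑-positive (λ _ → 1≤f _)) ⟩
  f t + sum (removeAt f t) ≡⟨ sym (sum-remove f) ⟩
  sum f                   ≤⟨ ∑f≤n ⟩
  suc n                   ∎)
  where open ≤-Reasoning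

∑-indicator-witness : ∀ {n} (b : Fin n → Bool) → 1 ≤ ∑[ t < n ] indicator (b t) → ∃ λ t → T (b t)
∑-indicator-witness {suc n} b 1≤∑ with b Fin.zero in eq
... | true  = Fin.zero , subst T (sym eq) _
... | false with ∑-indicator-witness (b ∘ Fin.suc) 1≤∑
...   | t , bt = Fin.suc t , bt

sumRange-cong : ∀ {f g : ℕ → ℕ} → (∀ i → f i ≡ g i) → ∀ a len → sumRange f a len ≡ sumRange g a len
sumRange-cong f≡g a zero      = refl
sumRange-cong f≡g a (suc len) = cong₂ _+_ (f≡g a) (sumRange-cong f≡g (suc a) len)

sumRange-mono-≤ : ∀ {f g : ℕ → ℕ} a len → (∀ {i} → i < a + len → f i ≤ g i) →
  sumRange f a len ≤ sumRange g a len
sumRange-mono-≤ a zero      f≤g = z≤n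
sumRange-mono-≤ a (suc len) f≤g = +-mono-≤
  (f≤g (m<m+n a z<s))
  (sumRange-mono-≤ (suc a) len (λ {i} i< → f≤g (subst (i <_) (sym (+-suc a len)) i<)))

sumRange-+ : ∀ (f g : ℕ → ℕ) a len →
  sumRange (λ i → f i + g i) a len ≡ sumRange f a len + sumRange g a len
sumRange-+ f g a zero      = refl
sumRange-+ f g a (suc len) = trans (cong (f a + g a +_) (sumRange-+ f g (suc a) len))
                                   (interchange (f a) (g a) _ _)

sumRange-const : ∀ c a len → sumRange (λ _ → c) a len ≡ len * c
sumRange-const c a zero      = refl
sumRange-const c a (suc len) = cong (c +_) (sumRange-const c (suc a) len)

sumRange-∑ : ∀ {n} (F : Fin n → ℕ → ℕ) a len →
  sumRange (λ i → ∑[ t < n ] F t i) a len ≡ ∑[ t < n ] sumRange (F t) a len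
sumRange-∑ {n} F a zero      = sym (sum-replicate-zero n)
sumRange-∑ {n} F a (suc len) = trans (cong (sum (λ t → F t a) +_) (sumRange-∑ F (suc a) len))
                                     (sym (∑-distrib-+ (λ t → F t a) (λ t → sumRange (F t) (suc a) len)))

sumRange-snoc : ∀ f a len → sumRange f a (suc len) ≡ sumRange f a len + f (a + len)
sumRange-snoc f a zero      = trans (+-identityʳ (f a)) (cong f (sym (+-identityʳ a)))
sumRange-snoc f a (suc len) = begin
  f a + sumRange f (suc a) (suc len)
    ≡⟨ cong (f a +_) (sumRange-snoc f (suc a) len) ⟩
  f a + (sumRange f (suc a) len + f (suc a + len))
    ≡⟨ +-assoc (f a) _ _ ⟨
  f a + sumRange f (suc a) len + f (suc a + len)
    ≡⟨ cong (λ m → f a + sumRange f (suc a) len + f m) (+-suc a len) ⟨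
  f a + sumRange f (suc a) len + f (a + suc len)
    ∎
  where open ≡-Reasoning

sumRange-suc : ∀ f a len → sumRange f (suc a) len ≡ sumRange (f ∘ suc) a len
sumRange-suc f a zero      = refl
sumRange-suc f a (suc len) = cong (f (suc a) +_) (sumRange-suc f (suc a) len)

sumRange-reverse : ∀ f a len → sumRange f a len ≡ sumRange (λ i → f (a + len ∸ i)) 1 len
sumRange-reverse f a zero      = refl
sumRange-reverse f a (suc len) = begin
  f a + sumRange f (suc a) len
    ≡⟨ cong (f a +_) (sumRange-reverse f (suc a) len) ⟩
  f a + sumRange (λ i → f (suc a + len ∸ i)) 1 len
    ≡⟨ +-comm (f a) _ ⟩
  sumRange (λ i → f (suc a + len ∸ i)) 1 len + f a
    ≡⟨ cong₂ _+_ (sumRange-cong (λ i → cong (λ m → f (m ∸ i)) (sym (+-suc a len))) 1 len)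
                 (cong f (sym (m+n∸n≡m a (suc len)))) ⟩
  sumRange (λ i → f (a + suc len ∸ i)) 1 len + f (a + suc len ∸ suc len)
    ≡⟨ sym (sumRange-snoc (λ i → f (a + suc len ∸ i)) 1 len) ⟩
  sumRange (λ i → f (a + suc len ∸ i)) 1 (suc len)
    ∎
  where open ≡-Reasoning

term≤sumRange : ∀ f a {len j} → j < len → f (a + j) ≤ sumRange f a len
term≤sumRange f a {suc len} {zero}  _   =
  subst (λ m → f m ≤ f a + sumRange f (suc a) len) (sym (+-identityʳ a)) (m≤m+n _ _)
term≤sumRange f a {suc len} {suc j} j<l = begin
  f (a + suc j)              ≡⟨ cong f (+-suc a j) ⟩
  f (suc a + j)              ≤⟨ term≤sumRange f (suc a) (s≤s⁻¹ j<l) ⟩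
  sumRange f (suc a) len     ≤⟨ m≤n+m _ (f a) ⟩
  f a + sumRange f (suc a) len ∎
  where open ≤-Reasoning

∑-increment : ∀ {n} (f g : Fin n → ℕ) j₀ → g j₀ ≡ suc (f j₀) → (∀ j → j ≢ j₀ → f j ≡ g j) →
  sum g ≡ suc (sum f)
∑-increment {suc n} f g j₀ g≡1+f f≡g = begin
  sum g                          ≡⟨ sum-remove g ⟩
  g j₀ + sum (removeAt g j₀)     ≡⟨ cong₂ _+_ g≡1+f (sum-cong-≗ (λ i → sym (f≡g _ (punchInᵢ≢i j₀ i)))) ⟩
  suc (f j₀ + sum (removeAt f j₀)) ≡⟨ cong suc (sum-remove f) ⟨
  suc (sum f)                    ∎
  where open ≡-Reasoning

sumRange-ends : ∀ f {len} → 1 < len → f 1 + f len ≤ sumRange f 1 len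
sumRange-ends f {suc zero} (s≤s ())
sumRange-ends f {suc (suc len)} _ = +-monoʳ-≤ (f 1) (term≤sumRange f 2 (n<1+n len))

sumRange-top : ∀ f {n k} → k ≤ n → sumRange f (n ∸ k) k ≡ sumRange (λ i → f (n ∸ i)) 1 k
sumRange-top f {n} {k} k≤n = trans (sumRange-reverse f (n ∸ k) k)
  (sumRange-cong (λ i → cong (λ m → f (m ∸ i)) (m∸n+n≡m k≤n)) 1 k)

sumRange-top-suc : ∀ f {n K} → suc K ≤ n →
  sumRange f (suc (n ∸ suc K)) (suc K) ≡ f n + sumRange (λ i → f (n ∸ i)) 1 K
sumRange-top-suc f {n} {K} k≤n = begin
  sumRange f (suc (n ∸ suc K)) (suc K)
    ≡⟨ sumRange-reverse f (suc (n ∸ suc K)) (suc K) ⟩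
  sumRange (λ i → f (suc (n ∸ suc K + suc K) ∸ i)) 1 (suc K)
    ≡⟨ sumRange-cong (λ i → cong (λ m → f (suc m ∸ i)) (m∸n+n≡m k≤n)) 1 (suc K) ⟩
  f n + sumRange (λ i → f (suc n ∸ i)) 2 K
    ≡⟨ cong (f n +_) (sumRange-suc (λ i → f (suc n ∸ i)) 1 K) ⟩
  f n + sumRange (λ i → f (n ∸ i)) 1 K
    ∎
  where open ≡-Reasoning

-- Missing lengths

indicator+indicator-not : ∀ b → indicator b + indicator (not b) ≡ 1
indicator+indicator-not true  = refl
indicator+indicator-not false = refl

indicator-not : ∀ {b} → ¬ T b → indicator (not b) ≡ 1
indicator-not {true}  ¬b = ⊥-elim (¬b _)
indicator-not {false} _  = refl

-- Q t i abstracts "the interval of length i at position t is in 𝓕", next the successor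
-- position, and K = k - 1.
module MissingLengths {n : ℕ} (next : Fin n → Fin n) (∑-next : ∀ f → ∑[ t < n ] f (next t) ≡ sum f)
         {K : ℕ} (1<K : 1 < K) (Q : Fin n → ℕ → Bool) where

  Full : Fin n → Set
  Full t = ∀ i → 1 ≤ i → i ≤ K → T (Q t i)

  missing : Fin n → ℕ
  missing t = sumRange (λ i → indicator (not (Q t i))) 1 K

  totalMissing : ℕ
  totalMissing = ∑[ t < n ] missing t

  present+missing : sumRange (λ i → ∑[ t < n ] indicator (Q t i)) 1 K + totalMissing ≡ K * n
  present+missing = begin
    sumRange (λ i → ∑[ t < n ] indicator (Q t i)) 1 K + totalMissing
      ≡⟨ cong (_+ totalMissing) (sumRange-∑ (λ t i → indicator (Q t i)) 1 K) ⟩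
    ∑[ t < n ] sumRange (λ i → indicator (Q t i)) 1 K + ∑[ t < n ] missing t
      ≡⟨ ∑-distrib-+ (λ t → sumRange (λ i → indicator (Q t i)) 1 K) missing ⟨
    ∑[ t < n ] (sumRange (λ i → indicator (Q t i)) 1 K + missing t)
      ≡⟨ sum-cong-≗ present+missing-at ⟩
    ∑[ t < n ] K
      ≡⟨ ∑-const n K ⟩
    n * K
      ≡⟨ *-comm n K ⟩
    K * n
      ∎
    where
    open ≡-Reasoning
    present+missing-at : ∀ t → sumRange (λ i → indicator (Q t i)) 1 K + missing t ≡ K
    present+missing-at t = begin
      sumRange (λ i → indicator (Q t i)) 1 K + missing t
        ≡⟨ sumRange-+ (λ i → indicator (Q t i)) (λ i → indicator (not (Q t i))) 1 K ⟨
      sumRange (λ i → indicator (Q t i) + indicator (not (Q t i))) 1 K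
        ≡⟨ sumRange-cong (λ i → indicator+indicator-not (Q t i)) 1 K ⟩
      sumRange (λ _ → 1) 1 K
        ≡⟨ sumRange-const 1 1 K ⟩
      K * 1
        ≡⟨ *-identityʳ K ⟩
      K ∎

  missing-≥1 : ∀ t {i} → 1 ≤ i → i ≤ K → ¬ T (Q t i) → 1 ≤ missing t
  missing-≥1 t {suc i} _ i<K ¬Q = subst (_≤ missing t) (indicator-not ¬Q) (term≤sumRange _ 1 i<K)

  missing≡0⇒Full : ∀ t → missing t ≡ 0 → Full t
  missing≡0⇒Full t missing≡0 i 1≤i i≤K = decidable-stable (T? (Q t i))
    (λ ¬Q → contradiction (subst (1 ≤_) missing≡0 (missing-≥1 t 1≤i i≤K ¬Q)) λ ())

  missing≤1⇒Q₁ : ∀ t → missing t ≤ 1 → ¬ T (Q t K) → T (Q t 1)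
  missing≤1⇒Q₁ t missing≤1 ¬QK = decidable-stable (T? (Q t 1)) λ ¬Q₁ → contradiction
    (≤-trans (subst₂ (λ a b → 2 ≤ a + b) (sym (indicator-not ¬Q₁)) (sym (indicator-not ¬QK)) ≤-refl)
             (≤-trans (sumRange-ends (λ i → indicator (not (Q t i))) 1<K) missing≤1))
    λ { (s≤s ()) }

  module _ (noY : ∀ t → Full (next t) → ¬ T (Q t K)) where

    missing-pair : ∀ t → 1 ≤ missing t + missing (next t)
    missing-pair t with missing (next t) in missing≡
    ... | zero  = ≤-trans (missing-≥1 t (<⇒≤ 1<K) ≤-refl (noY t (missing≡0⇒Full (next t) missing≡)))
                          (m≤m+n _ 0)
    ... | suc _ = ≤-trans (s≤s z≤n) (m≤n+m _ _)

    ∑-missing-pair : ∑[ t < n ] (missing t + missing (next t)) ≡ totalMissing + totalMissing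
    ∑-missing-pair = trans (∑-distrib-+ missing (missing ∘ next))
                           (cong (totalMissing +_) (∑-next missing))

    n≤2*totalMissing : n ≤ totalMissing + totalMissing
    n≤2*totalMissing = ≤-trans (∑-positive missing-pair) (≤-reflexive ∑-missing-pair)

    module _ (noY'₁ : ∀ t → Full t → T (Q (next t) 1) → ¬ T (Q t (suc K)))
             (noY'₂ : ∀ t → Full (next t) → T (Q (next (next t)) 1) → ¬ T (Q t (suc K))) where

      module _ (tight : totalMissing + totalMissing ≤ n) where
        private
          pair≤1 : ∀ s → missing s + missing (next s) ≤ 1
          pair≤1 = ∑-positive-tight missing-pair (≤-trans (≤-reflexive ∑-missing-pair) tight)

          second≤1 : ∀ s → missing (next s) ≤ 1
          second≤1 s = ≤-trans (m≤n+m _ (missing s)) (pair≤1 s)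

          next-full : ∀ s → 1 ≤ missing s → missing (next s) ≡ 0
          next-full s 1≤missing = n≤0⇒n≡0 (s≤s⁻¹ (≤-trans (+-monoˡ-≤ _ 1≤missing) (pair≤1 s)))

          next-missing : ∀ s → missing s ≡ 0 → 1 ≤ missing (next s)
          next-missing s missing≡0 = subst (λ m → 1 ≤ m + missing (next s)) missing≡0 (missing-pair s)

          Q₁ : ∀ s → missing (next (next s)) ≡ 0 → missing (next s) ≤ 1 → T (Q (next s) 1)
          Q₁ s missing₂≡0 missing₁≤1 =
            missing≤1⇒Q₁ (next s) missing₁≤1 (noY (next s) (missing≡0⇒Full _ missing₂≡0))

        tight⇒no-long : ∀ t → ¬ T (Q t (suc K))
        tight⇒no-long t with missing t in missing≡
        ... | zero  = noY'₁ t (missing≡0⇒Full t missing≡)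
                          (Q₁ t (next-full (next t) (next-missing t missing≡)) (second≤1 t))
        ... | suc _ = noY'₂ t (missing≡0⇒Full (next t) missing₁≡0)
                          (Q₁ (next t) (next-full (next (next t)) (next-missing (next t) missing₁≡0))
                                       (second≤1 (next t)))
          where missing₁≡0 = next-full t (subst (1 ≤_) (sym missing≡) (s≤s z≤n))

      half<totalMissing : (∃ λ t → T (Q t (suc K))) → n / 2 < totalMissing
      half<totalMissing (t , Q-long) with n <? totalMissing + totalMissing
      ... | yes n<2S = m<n*o⇒m/o<n (subst (n <_) 2S≡S*2 n<2S)
        where
        2S≡S*2 : totalMissing + totalMissing ≡ totalMissing * 2
        2S≡S*2 = trans (cong (totalMissing +_) (sym (+-identityʳ _))) (*-comm 2 totalMissing)
      ... | no  n≮2S = ⊥-elim (tight⇒no-long (≮⇒≥ n≮2S) t Q-long)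

-- Copies of Y_k and Y'_k

⊆∧∣<∣⇒⊂ : ∀ {p q : Subset n} → p ⊆ q → ∣ p ∣ < ∣ q ∣ → p ⊂ q
⊆∧∣<∣⇒⊂ {p = p} {q} p⊆q ∣p∣<∣q∣ with any? (λ x → x ∈? q ×-dec ¬? (x ∈? p))
... | yes new = p⊆q , new
... | no ¬new = contradiction (cong ∣_∣ (⊆-antisym p⊆q q⊆p)) (<⇒≢ ∣p∣<∣q∣)
  where
  q⊆p : q ⊆ p
  q⊆p {x} x∈q = decidable-stable (x ∈? p) (λ x∉p → ¬new (x , x∈q , x∉p))

∁-injective : ∀ {p q : Subset n} → ∁ p ≡ ∁ q → p ≡ q
∁-injective {n} {p} {q} ∁p≡∁q = begin
  p         ≡⟨ ¬-involutive p ⟨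
  ∁ (∁ p)   ≡⟨ cong ∁ ∁p≡∁q ⟩
  ∁ (∁ q)   ≡⟨ ¬-involutive q ⟩
  q         ∎
  where
  open ≡-Reasoning
  open BooleanAlgebraProperties (∪-∩-booleanAlgebra n) using (¬-involutive)

∣∣<⇒≢ : ∀ {p q : Subset n} → ∣ p ∣ < ∣ q ∣ → p ≢ q
∣∣<⇒≢ ∣p∣<∣q∣ p≡q = <⇒≢ ∣p∣<∣q∣ (cong ∣_∣ p≡q)

m+o≡n+p⇒p<o⇒m<n : ∀ {m n o p} → m + o ≡ n + p → p < o → m < n
m+o≡n+p⇒p<o⇒m<n {m} {n} {o} {p} eq p<o = +-cancelʳ-< o m n (begin-strict
  m + o   ≡⟨ eq ⟩
  n + p   <⟨ +-monoʳ-< n p<o ⟩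
  n + o   ∎)
  where open ≤-Reasoning

n∸b+d≡n∸a : ∀ {a b d n} → a + d ≡ b → b ≤ n → n ∸ b + d ≡ n ∸ a
n∸b+d≡n∸a {a} {b} {d} {n} a+d≡b b≤n = begin
  n ∸ b + d         ≡⟨ cong (λ x → n ∸ x + d) (sym a+d≡b) ⟩
  n ∸ (a + d) + d   ≡⟨ cong (_+ d) (sym (∸-+-assoc n a d)) ⟩
  n ∸ a ∸ d + d     ≡⟨ m∸n+n≡m (m+n≤o⇒m≤o∸n d (subst (_≤ n) (trans (sym a+d≡b) (+-comm a d)) b≤n)) ⟩
  n ∸ a             ∎
  where open ≡-Reasoning

-- Strictness of the inclusions and distinctness of the k+1 sets follow from their sizes.
module _ {𝓕 : Family n} {K : ℕ} (1≤K : 1 ≤ K) {F₁ F₂ : Subset n} (G : ℕ → Subset n)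
         (F₁∈𝓕 : F₁ ∈𝓕 𝓕) (F₂∈𝓕 : F₂ ∈𝓕 𝓕) (F₁≢F₂ : F₁ ≢ F₂) (∣F₁∣≡∣F₂∣ : ∣ F₁ ∣ ≡ ∣ F₂ ∣) where

  ContainsY-intro :
    (∀ i → 1 ≤ i → i ≤ K → G i ∈𝓕 𝓕 × ∣ G i ∣ + (suc K ∸ i) ≡ ∣ F₁ ∣) →
    (∀ i → 1 ≤ i → i < K → G i ⊆ G (suc i)) → G K ⊆ F₁ → G K ⊆ F₂ →
    ContainsY (suc K) 𝓕
  ContainsY-intro level G⊆G GK⊆F₁ GK⊆F₂ =
    F₁ , F₂ , G , F₁∈𝓕 , F₂∈𝓕 , (λ i a b → proj₁ (level i a b)) , F₁≢F₂ ,
    (λ i a b → ≢-sym (∣∣<⇒≢ (∣G∣<∣F₁∣ a b)) , ≢-sym (∣∣<⇒≢ (∣G∣<∣F₂∣ a b))) ,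
    (λ i j a i<j j≤K → ∣∣<⇒≢ (∣G∣<∣G∣ a i<j j≤K)) ,
    (λ i a i<K → ⊆∧∣<∣⇒⊂ (G⊆G i a i<K) (∣G∣<∣G∣ a ≤-refl i<K)) ,
    ⊆∧∣<∣⇒⊂ GK⊆F₁ (∣G∣<∣F₁∣ 1≤K ≤-refl) ,
    ⊆∧∣<∣⇒⊂ GK⊆F₂ (∣G∣<∣F₂∣ 1≤K ≤-refl) ,
    ∣F₁∣≡∣F₂∣ , (λ i a b → proj₂ (level i a b))
    where
    ∣G∣<∣F₁∣ : ∀ {i} → 1 ≤ i → i ≤ K → ∣ G i ∣ < ∣ F₁ ∣
    ∣G∣<∣F₁∣ {i} 1≤i i≤K =
      subst (∣ G i ∣ <_) (proj₂ (level i 1≤i i≤K)) (m<m+n ∣ G i ∣ (m<n⇒0<n∸m (s≤s i≤K)))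
    ∣G∣<∣F₂∣ : ∀ {i} → 1 ≤ i → i ≤ K → ∣ G i ∣ < ∣ F₂ ∣
    ∣G∣<∣F₂∣ 1≤i i≤K = subst (_ <_) ∣F₁∣≡∣F₂∣ (∣G∣<∣F₁∣ 1≤i i≤K)
    ∣G∣<∣G∣ : ∀ {i j} → 1 ≤ i → i < j → j ≤ K → ∣ G i ∣ < ∣ G j ∣
    ∣G∣<∣G∣ {i} {j} 1≤i i<j j≤K =
      m+o≡n+p⇒p<o⇒m<n (trans (proj₂ (level i 1≤i (<⇒≤ (<-≤-trans i<j j≤K))))
                             (sym (proj₂ (level j (≤-trans 1≤i (<⇒≤ i<j)) j≤K))))
                      (∸-monoʳ-< i<j (m≤n⇒m≤1+n j≤K))

  ContainsY'-intro :
    (∀ i → 1 ≤ i → i ≤ K → G i ∈𝓕 𝓕 × ∣ F₁ ∣ + (suc K ∸ i) ≡ ∣ G i ∣) →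
    (∀ i → 1 ≤ i → i < K → G (suc i) ⊆ G i) → F₁ ⊆ G K → F₂ ⊆ G K →
    ContainsY' (suc K) 𝓕
  ContainsY'-intro level G⊇G F₁⊆GK F₂⊆GK =
    F₁ , F₂ , G , F₁∈𝓕 , F₂∈𝓕 , (λ i a b → proj₁ (level i a b)) , F₁≢F₂ ,
    (λ i a b → ∣∣<⇒≢ (∣F₁∣<∣G∣ a b) , ∣∣<⇒≢ (∣F₂∣<∣G∣ a b)) ,
    (λ i j a i<j j≤K → ≢-sym (∣∣<⇒≢ (∣G∣>∣G∣ a i<j j≤K))) ,
    (λ i a i<K → ⊆∧∣<∣⇒⊂ (G⊇G i a i<K) (∣G∣>∣G∣ a ≤-refl i<K)) ,
    ⊆∧∣<∣⇒⊂ F₁⊆GK (∣F₁∣<∣G∣ 1≤K ≤-refl) ,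
    ⊆∧∣<∣⇒⊂ F₂⊆GK (∣F₂∣<∣G∣ 1≤K ≤-refl) ,
    ∣F₁∣≡∣F₂∣ , (λ i a b → proj₂ (level i a b))
    where
    ∣F₁∣<∣G∣ : ∀ {i} → 1 ≤ i → i ≤ K → ∣ F₁ ∣ < ∣ G i ∣
    ∣F₁∣<∣G∣ {i} 1≤i i≤K =
      subst (∣ F₁ ∣ <_) (proj₂ (level i 1≤i i≤K)) (m<m+n ∣ F₁ ∣ (m<n⇒0<n∸m (s≤s i≤K)))
    ∣F₂∣<∣G∣ : ∀ {i} → 1 ≤ i → i ≤ K → ∣ F₂ ∣ < ∣ G i ∣
    ∣F₂∣<∣G∣ 1≤i i≤K = subst (_< _) ∣F₁∣≡∣F₂∣ (∣F₁∣<∣G∣ 1≤i i≤K)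
    ∣G∣>∣G∣ : ∀ {i j} → 1 ≤ i → i < j → j ≤ K → ∣ G j ∣ < ∣ G i ∣
    ∣G∣>∣G∣ {i} {j} 1≤i i<j j≤K =
      subst₂ _<_ (proj₂ (level j (≤-trans 1≤i (<⇒≤ i<j)) j≤K))
                 (proj₂ (level i 1≤i (<⇒≤ (<-≤-trans i<j j≤K))))
                 (+-monoʳ-< ∣ F₁ ∣ (∸-monoʳ-< i<j (m≤n⇒m≤1+n j≤K)))

∣∁∣-level : ∀ (p q : Subset n) {d} → ∣ p ∣ + d ≡ ∣ q ∣ → ∣ ∁ q ∣ + d ≡ ∣ ∁ p ∣
∣∁∣-level {n} p q eq = begin
  ∣ ∁ q ∣ + _     ≡⟨ cong (_+ _) (∣∁p∣≡n∸∣p∣ q) ⟩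
  n ∸ ∣ q ∣ + _   ≡⟨ n∸b+d≡n∸a eq (∣p∣≤n q) ⟩
  n ∸ ∣ p ∣       ≡⟨ ∣∁p∣≡n∸∣p∣ p ⟨
  ∣ ∁ p ∣         ∎
  where open ≡-Reasoning

∣∁∣-cong : ∀ (p q : Subset n) → ∣ p ∣ ≡ ∣ q ∣ → ∣ ∁ p ∣ ≡ ∣ ∁ q ∣
∣∁∣-cong p q eq = trans (∣∁p∣≡n∸∣p∣ p) (trans (cong (_ ∸_) eq) (sym (∣∁p∣≡n∸∣p∣ q)))

∁-≢ : ∀ {p q : Subset n} → p ≢ q → ∁ p ≢ ∁ q
∁-≢ p≢q = p≢q ∘ ∁-injective

ContainsY-∁ : ∀ {k} {𝓕 : Family n} → ContainsY k (𝓕 ∘ ∁) → ContainsY' k 𝓕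
ContainsY-∁ (F₁ , F₂ , G , F₁∈ , F₂∈ , G∈ , F₁≢F₂ , F≢G , G≢G , G⊂G , GK⊂F₁ , GK⊂F₂ , ∣F₁∣≡∣F₂∣ , lvl) =
  ∁ F₁ , ∁ F₂ , ∁ ∘ G , F₁∈ , F₂∈ , G∈ , ∁-≢ F₁≢F₂ ,
  (λ i a b → ∁-≢ (proj₁ (F≢G i a b)) , ∁-≢ (proj₂ (F≢G i a b))) ,
  (λ i j a b c → ∁-≢ (G≢G i j a b c)) ,
  (λ i a b → p⊂q⇒∁p⊃∁q (G⊂G i a b)) , p⊂q⇒∁p⊃∁q GK⊂F₁ , p⊂q⇒∁p⊃∁q GK⊂F₂ ,
  ∣∁∣-cong F₁ F₂ ∣F₁∣≡∣F₂∣ , (λ i a b → ∣∁∣-level (G i) F₁ (lvl i a b))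

ContainsY'-∁ : ∀ {k} {𝓕 : Family n} → ContainsY' k (𝓕 ∘ ∁) → ContainsY k 𝓕
ContainsY'-∁ (F₁ , F₂ , G , F₁∈ , F₂∈ , G∈ , F₁≢F₂ , F≢G , G≢G , G⊃G , F₁⊂GK , F₂⊂GK , ∣F₁∣≡∣F₂∣ , lvl) =
  ∁ F₁ , ∁ F₂ , ∁ ∘ G , F₁∈ , F₂∈ , G∈ , ∁-≢ F₁≢F₂ ,
  (λ i a b → ∁-≢ (proj₁ (F≢G i a b)) , ∁-≢ (proj₂ (F≢G i a b))) ,
  (λ i j a b c → ∁-≢ (G≢G i j a b c)) ,
  (λ i a b → p⊂q⇒∁p⊃∁q (G⊃G i a b)) , p⊂q⇒∁p⊃∁q F₁⊂GK , p⊂q⇒∁p⊃∁q F₂⊂GK ,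
  ∣∁∣-cong F₁ F₂ ∣F₁∣≡∣F₂∣ , (λ i a b → ∣∁∣-level F₁ (G i) (lvl i a b))

-- Arithmetic modulo n

module _ (n : ℕ) where

  _⊖_ : ℕ → ℕ → ℕ
  p ⊖ t = if t ≤ᵇ p then p ∸ t else p + n ∸ t

  AddMod : ℕ → ℕ → ℕ → Set
  AddMod t v p = t + v ≡ p ⊎ t + v ≡ p + n

  private
    ≢+n : ∀ {x} → x < n → ∀ y → x ≢ y + n
    ≢+n x<n y x≡y+n = <⇒≱ x<n (subst (n ≤_) (sym x≡y+n) (m≤n+m n y))

  ⊖-AddMod : ∀ {t p} → t < n → AddMod t (p ⊖ t) p
  ⊖-AddMod {t} {p} t<n with t ≤ᵇ p | ≤ᵇ-reflects-≤ t p
  ... | true  | ofʸ t≤p = inj₁ (m+[n∸m]≡n t≤p)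
  ... | false | ofⁿ t≰p = inj₂ (m+[n∸m]≡n (≤-trans (<⇒≤ t<n) (m≤n+m n p)))

  ⊖-< : ∀ {t p} → t < n → p < n → p ⊖ t < n
  ⊖-< {t} {p} t<n p<n with t ≤ᵇ p | ≤ᵇ-reflects-≤ t p
  ... | true  | ofʸ t≤p = ≤-<-trans (m∸n≤m p t) p<n
  ... | false | ofⁿ t≰p = +-cancelˡ-< t _ _ (begin-strict
    t + (p + n ∸ t)   ≡⟨ m+[n∸m]≡n (≤-trans (<⇒≤ t<n) (m≤n+m n p)) ⟩
    p + n             <⟨ +-monoˡ-< n (≰⇒> t≰p) ⟩
    t + n             ∎)
    where open ≤-Reasoning

  AddMod-unique : ∀ {t v v' p} → v < n → v' < n → AddMod t v p → AddMod t v' p → v ≡ v'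
  AddMod-unique {t} _ _ (inj₁ a) (inj₁ b) = +-cancelˡ-≡ t _ _ (trans a (sym b))
  AddMod-unique {t} _ _ (inj₂ a) (inj₂ b) = +-cancelˡ-≡ t _ _ (trans a (sym b))
  AddMod-unique {t} {v} {v'} _ v'<n (inj₁ a) (inj₂ b) =
    ⊥-elim (≢+n v'<n v (+-cancelˡ-≡ t _ _ (trans b (trans (cong (_+ n) (sym a)) (+-assoc t v n)))))
  AddMod-unique {t} {v} {v'} v<n _ (inj₂ a) (inj₁ b) =
    ⊥-elim (≢+n v<n v' (+-cancelˡ-≡ t _ _ (trans a (trans (cong (_+ n) (sym b)) (+-assoc t v' n)))))

  AddMod-injective : ∀ {t v p q} → p < n → q < n → AddMod t v p → AddMod t v q → p ≡ q
  AddMod-injective _   _   (inj₁ a) (inj₁ b) = trans (sym a) b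
  AddMod-injective _   _   (inj₂ a) (inj₂ b) = +-cancelʳ-≡ n _ _ (trans (sym a) b)
  AddMod-injective {q = q} p<n _   (inj₁ a) (inj₂ b) = ⊥-elim (≢+n p<n q (trans (sym a) b))
  AddMod-injective {p = p} _   q<n (inj₂ a) (inj₁ b) = ⊥-elim (≢+n q<n p (trans (sym b) a))

  ⊖-unique : ∀ {t v p} → t < n → p < n → v < n → AddMod t v p → p ⊖ t ≡ v
  ⊖-unique t<n p<n v<n t+v≡p = AddMod-unique (⊖-< t<n p<n) v<n (⊖-AddMod t<n) t+v≡p

  ⊖-injective : ∀ {t p q} → t < n → p < n → q < n → p ⊖ t ≡ q ⊖ t → p ≡ q
  ⊖-injective {t} {p} {q} t<n p<n q<n eq =
    AddMod-injective {t = t} p<n q<n (⊖-AddMod t<n) (subst (λ v → AddMod t v q) (sym eq) (⊖-AddMod t<n))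

  ⊖-surjective : ∀ {t v} → t < n → v < n → ∃ λ p → p < n × p ⊖ t ≡ v
  ⊖-surjective {t} {v} t<n v<n with t + v <? n
  ... | yes t+v<n = t + v , t+v<n , ⊖-unique t<n t+v<n v<n (inj₁ refl)
  ... | no  t+v≮n = t + v ∸ n , p<n , ⊖-unique t<n p<n v<n (inj₂ (sym (m∸n+n≡m n≤t+v)))
    where
    n≤t+v = ≮⇒≥ t+v≮n
    p<n : t + v ∸ n < n
    p<n = +-cancelʳ-< n _ _ (subst (_< n + n) (sym (m∸n+n≡m n≤t+v)) (+-mono-< t<n v<n))

  prev : ℕ → ℕ
  prev zero    = n ∸ 1
  prev (suc v) = v

  private
    1+[n∸1]≡n : 0 < n → suc (n ∸ 1) ≡ n
    1+[n∸1]≡n 0<n = trans (+-comm 1 (n ∸ 1)) (m∸n+n≡m 0<n)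

    t+[1+x]≡t'+x+n : ∀ {t x} t' → t + 1 ≡ t' + n → t + suc x ≡ t' + x + n
    t+[1+x]≡t'+x+n {t} {x} t' b = begin
      t + suc x       ≡⟨ sym (+-assoc t 1 x) ⟩
      t + 1 + x       ≡⟨ cong (_+ x) b ⟩
      t' + n + x      ≡⟨ +-assoc t' n x ⟩
      t' + (n + x)    ≡⟨ cong (t' +_) (+-comm n x) ⟩
      t' + (x + n)    ≡⟨ sym (+-assoc t' x n) ⟩
      t' + x + n      ∎
      where open ≡-Reasoning

  AddMod-prev : ∀ {t t' v p} → t < n → p < n → AddMod t v p → AddMod t 1 t' → AddMod t' (prev v) p
  AddMod-prev {t} {v = zero} {p} t<n _ (inj₂ a) _ =
    ⊥-elim (≢+n t<n p (trans (sym (+-identityʳ t)) a))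
  AddMod-prev {t} {t'} {zero} {p} t<n _ (inj₁ a) (inj₁ b) = inj₂ (begin
    t' + (n ∸ 1)         ≡⟨ cong (_+ (n ∸ 1)) (sym b) ⟩
    t + 1 + (n ∸ 1)      ≡⟨ +-assoc t 1 (n ∸ 1) ⟩
    t + suc (n ∸ 1)      ≡⟨ cong₂ _+_ (trans (sym (+-identityʳ t)) a) (1+[n∸1]≡n (≤-<-trans z≤n t<n)) ⟩
    p + n                ∎)
    where open ≡-Reasoning
  AddMod-prev {t} {t'} {zero} {p} t<n _ (inj₁ a) (inj₂ b) = inj₁ (suc-injective (begin
    suc (t' + (n ∸ 1))   ≡⟨ sym (+-suc t' (n ∸ 1)) ⟩
    t' + suc (n ∸ 1)     ≡⟨ cong (t' +_) (1+[n∸1]≡n (≤-<-trans z≤n t<n)) ⟩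
    t' + n               ≡⟨ sym b ⟩
    t + 1                ≡⟨ cong (_+ 1) (trans (sym (+-identityʳ t)) a) ⟩
    p + 1                ≡⟨ +-comm p 1 ⟩
    suc p                ∎))
    where open ≡-Reasoning
  AddMod-prev {t} {t'} {suc x} {p} _ _ t+v≡p (inj₁ b) =
    subst (λ s → AddMod s x p) b (subst (λ s → s ≡ p ⊎ s ≡ p + n) (sym (+-assoc t 1 x)) t+v≡p)
  AddMod-prev {t} {t'} {suc x} {p} _ p<n (inj₁ a) (inj₂ b) =
    ⊥-elim (≢+n p<n (t' + x) (trans (sym a) (t+[1+x]≡t'+x+n t' b)))
  AddMod-prev {t} {t'} {suc x} {p} _ _ (inj₂ a) (inj₂ b) =
    inj₁ (+-cancelʳ-≡ n _ _ (trans (sym (t+[1+x]≡t'+x+n t' b)) a))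

  AddMod-prev-suc : ∀ {w c v} → suc c ≤ n → AddMod w c v → AddMod (prev w) (suc c) v
  AddMod-prev-suc {zero} {c} {v} c<n (inj₁ a) = inj₂ (begin
    n ∸ 1 + suc c       ≡⟨ +-suc (n ∸ 1) c ⟩
    suc (n ∸ 1) + c     ≡⟨ cong (_+ c) (1+[n∸1]≡n (≤-<-trans z≤n c<n)) ⟩
    n + c               ≡⟨ +-comm n c ⟩
    c + n               ≡⟨ cong (_+ n) a ⟩
    v + n               ∎)
    where open ≡-Reasoning
  AddMod-prev-suc {zero} {c} {v} c<n (inj₂ a) = ⊥-elim (≢+n c<n v a)
  AddMod-prev-suc {suc x} {c} {v} _ w+c≡v = subst (λ s → s ≡ v ⊎ s ≡ v + n) (sym (+-suc x c)) w+c≡v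

  prev-< : ∀ {v} → v < n → prev v < n
  prev-< {zero}  0<n   = ∸-monoʳ-< (s≤s z≤n) 0<n
  prev-< {suc v} 1+v<n = <-trans (n<1+n v) 1+v<n

  prev<⇒<suc : ∀ {v l} → prev v < l → v < suc l
  prev<⇒<suc {zero}  _  = s≤s z≤n
  prev<⇒<suc {suc v} v<l = s≤s v<l

<ᵇ-true : ∀ {m n} → m < n → (m <ᵇ n) ≡ true
<ᵇ-true (s≤s z≤n)       = refl
<ᵇ-true (s≤s (s≤s m<n)) = <ᵇ-true (s≤s m<n)

<ᵇ-false : ∀ {m n} → n ≤ m → (m <ᵇ n) ≡ false
<ᵇ-false z≤n       = refl
<ᵇ-false (s≤s n≤m) = <ᵇ-false n≤m

<ᵇ-suc : ∀ {v s} → v ≢ s → (v <ᵇ suc s) ≡ (v <ᵇ s)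
<ᵇ-suc {zero}  {zero}  v≢s = ⊥-elim (v≢s refl)
<ᵇ-suc {zero}  {suc s} _   = refl
<ᵇ-suc {suc v} {zero}  _   = refl
<ᵇ-suc {suc v} {suc s} v≢s = <ᵇ-suc (v≢s ∘ cong suc)

AddMod-∁ : ∀ {n w i v} → w < n → v < n → AddMod n w i v → not (v <ᵇ i) ≡ (w <ᵇ n ∸ i)
AddMod-∁ {n} {w} {i} {v} w<n v<n (inj₁ w+i≡v) =
  trans (cong not (<ᵇ-false (subst (i ≤_) w+i≡v (m≤n+m i w))))
        (sym (<ᵇ-true (m+n≤o⇒m≤o∸n (suc w) (subst (_< n) (sym w+i≡v) v<n))))
AddMod-∁ {n} {w} {i} {v} w<n v<n (inj₂ w+i≡v+n) =
  trans (cong not (<ᵇ-true v<i)) (sym (<ᵇ-false n∸i≤w))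
  where
  v<i : v < i
  v<i = +-cancelʳ-< n v i (begin-strict
    v + n   ≡⟨ sym w+i≡v+n ⟩
    w + i   <⟨ +-monoˡ-< i w<n ⟩
    n + i   ≡⟨ +-comm n i ⟩
    i + n   ∎)
    where open ≤-Reasoning
  n∸i≤w : n ∸ i ≤ w
  n∸i≤w = subst (n ∸ i ≤_) (m+n∸n≡m w i)
            (∸-monoˡ-≤ i (subst (n ≤_) (sym w+i≡v+n) (m≤n+m n v)))

-- Intervals along a cyclic permutation

next : Fin n → Fin n
next {suc m} t with suc (toℕ t) <? suc m
... | yes 1+t<n = fromℕ< 1+t<n
... | no  _     = Fin.zero

next-AddMod : (t : Fin n) → AddMod n (toℕ t) 1 (toℕ (next t))
next-AddMod {suc m} t with suc (toℕ t) <? suc m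
... | yes 1+t<n = inj₁ (trans (+-comm (toℕ t) 1) (sym (toℕ-fromℕ< 1+t<n)))
... | no  1+t≮n = inj₂ (trans (+-comm (toℕ t) 1) (≤-antisym (toℕ<n t) (≮⇒≥ 1+t≮n)))

next-inject₁ : ∀ {m} (i : Fin m) → next (inject₁ i) ≡ Fin.suc i
next-inject₁ {m} i = toℕ-injective (AddMod-injective (suc m) {toℕ (inject₁ i)} {1}
  (toℕ<n _) (toℕ<n (Fin.suc i)) (next-AddMod (inject₁ i))
  (inj₁ (trans (+-comm _ 1) (cong suc (toℕ-inject₁ i)))))

next-fromℕ : ∀ m → next (fromℕ m) ≡ Fin.zero
next-fromℕ m = toℕ-injective (AddMod-injective (suc m) {toℕ (fromℕ m)} {1}
  (toℕ<n (next (fromℕ m))) (s≤s z≤n) (next-AddMod (fromℕ m))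
  (inj₂ (trans (+-comm _ 1) (cong suc (toℕ-fromℕ m)))))

∑-next : (f : Fin n → ℕ) → ∑[ t < n ] f (next t) ≡ sum f
∑-next {zero}  f = refl
∑-next {suc m} f = begin
  ∑[ t < suc m ] f (next t)                      ≡⟨ sum-init-last (f ∘ next) ⟩
  ∑[ i < m ] f (next (inject₁ i)) + f (next (fromℕ m))
    ≡⟨ cong₂ _+_ (sum-cong-≗ (cong f ∘ next-inject₁)) (cong f (next-fromℕ m)) ⟩
  ∑[ i < m ] f (Fin.suc i) + f Fin.zero            ≡⟨ +-comm _ (f Fin.zero) ⟩
  sum f                                          ∎
  where open ≡-Reasoning

rotate : ℕ → Fin n → Fin n
rotate zero    t = t
rotate (suc c) t = next (rotate c t)

∑-rotate : ∀ c (f : Fin n → ℕ) → ∑[ t < n ] f (rotate c t) ≡ sum f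
∑-rotate zero    f = refl
∑-rotate (suc c) f = trans (∑-rotate c (f ∘ next)) (∑-next f)

∣tabulate∣≡∑ : (f : Fin n → Bool) → ∣ tabulate f ∣ ≡ ∑[ j < n ] indicator (f j)
∣tabulate∣≡∑ {zero}  f = refl
∣tabulate∣≡∑ {suc n} f with f Fin.zero
... | true  = cong suc (∣tabulate∣≡∑ (f ∘ Fin.suc))
... | false = ∣tabulate∣≡∑ (f ∘ Fin.suc)

∈tabulate⇔ : ∀ {f : Fin n → Bool} {j} → j ∈ tabulate f ⇔ T (f j)
∈tabulate⇔ {f = f} {j} = mk⇔
  (λ j∈ → Equivalence.from T-≡ (trans (sym (lookup∘tabulate f j)) ([]=⇒lookup j∈)))
  (λ fj → lookup⇒[]= j (tabulate f) (trans (lookup∘tabulate f j) (Equivalence.to T-≡ fj)))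

module _ (σ : Permutation′ n) where

  -- The position of j along σ, counted from the position of t; interval σ t s is
  -- definitionally the set of j with offset t j < s.
  offset : Fin n → Fin n → ℕ
  offset t j = _⊖_ n (toℕ (σ ⟨$⟩ˡ j)) (toℕ t)

  offset-< : ∀ t j → offset t j < n
  offset-< t j = ⊖-< n (toℕ<n t) (toℕ<n (σ ⟨$⟩ˡ j))

  offset-next : ∀ t j → offset (next t) j ≡ prev n (offset t j)
  offset-next t j = ⊖-unique n (toℕ<n (next t)) (toℕ<n (σ ⟨$⟩ˡ j)) (prev-< n (offset-< t j))
    (AddMod-prev n (toℕ<n t) (toℕ<n (σ ⟨$⟩ˡ j)) (⊖-AddMod n (toℕ<n t)) (next-AddMod t))

  offset-rotate : ∀ {c} t j → c ≤ n → AddMod n (offset (rotate c t) j) c (offset t j)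
  offset-rotate {zero}  t j _   = inj₁ (+-identityʳ _)
  offset-rotate {suc c} t j c<n = subst (λ w → AddMod n w (suc c) (offset t j))
    (sym (offset-next (rotate c t) j)) (AddMod-prev-suc n c<n (offset-rotate t j (<⇒≤ c<n)))

  offset-injective : ∀ t {j j'} → offset t j ≡ offset t j' → j ≡ j'
  offset-injective t {j} {j'} eq = begin
    j                      ≡⟨ inverseʳ σ ⟨
    σ ⟨$⟩ʳ (σ ⟨$⟩ˡ j)      ≡⟨ cong (σ ⟨$⟩ʳ_) (toℕ-injective
                                (⊖-injective n (toℕ<n t) (toℕ<n (σ ⟨$⟩ˡ j)) (toℕ<n (σ ⟨$⟩ˡ j')) eq)) ⟩
    σ ⟨$⟩ʳ (σ ⟨$⟩ˡ j')     ≡⟨ inverseʳ σ ⟩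
    j'                     ∎
    where open ≡-Reasoning

  offset-surjective : ∀ t {v} → v < n → ∃ λ j → offset t j ≡ v
  offset-surjective t v<n with ⊖-surjective n (toℕ<n t) v<n
  ... | p , p<n , p⊖t≡v = σ ⟨$⟩ʳ fromℕ< p<n , (begin
    offset t (σ ⟨$⟩ʳ fromℕ< p<n)               ≡⟨ cong (λ i → _⊖_ n (toℕ i) (toℕ t)) (inverseˡ σ) ⟩
    _⊖_ n (toℕ (fromℕ< p<n)) (toℕ t)           ≡⟨ cong (λ i → _⊖_ n i (toℕ t)) (toℕ-fromℕ< p<n) ⟩
    _⊖_ n p (toℕ t)                           ≡⟨ p⊖t≡v ⟩
    _                                         ∎)
    where open ≡-Reasoning

  ∈interval⁻ : ∀ t s {j} → j ∈ interval σ t s → offset t j < s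
  ∈interval⁻ t s = <ᵇ⇒< _ _ ∘ Equivalence.to ∈tabulate⇔

  ∈interval⁺ : ∀ t s {j} → offset t j < s → j ∈ interval σ t s
  ∈interval⁺ t s = Equivalence.from ∈tabulate⇔ ∘ <⇒<ᵇ

  interval-card : ∀ t {s} → s ≤ n → ∣ interval σ t s ∣ ≡ s
  interval-card t {s} s≤n = trans (∣tabulate∣≡∑ (λ j → offset t j <ᵇ s)) (count s s≤n)
    where
    count : ∀ s → s ≤ n → ∑[ j < n ] indicator (offset t j <ᵇ s) ≡ s
    count zero    _   = sum-replicate-zero n
    count (suc s) s<n with offset-surjective t s<n
    ... | j₀ , offset≡s = trans
      (∑-increment _ _ j₀ (subst (λ v → indicator (v <ᵇ suc s) ≡ suc (indicator (v <ᵇ s)))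
                                 (sym offset≡s) (1+indicator s))
                          (λ j j≢j₀ → cong indicator (sym (<ᵇ-suc (offset≢s j j≢j₀)))))
      (cong suc (count s (<⇒≤ s<n)))
      where
      offset≢s : ∀ j → j ≢ j₀ → offset t j ≢ s
      offset≢s j j≢j₀ eq = j≢j₀ (offset-injective t (trans eq (sym offset≡s)))
      1+indicator : ∀ s → indicator (s <ᵇ suc s) ≡ suc (indicator (s <ᵇ s))
      1+indicator zero    = refl
      1+indicator (suc s) = 1+indicator s

  interval-mono : ∀ t {s s'} → s ≤ s' → interval σ t s ⊆ interval σ t s'
  interval-mono t {s} {s'} s≤s' j∈ = ∈interval⁺ t s' (<-≤-trans (∈interval⁻ t s j∈) s≤s')

  interval-next⊆ : ∀ t {l} → interval σ (next t) l ⊆ interval σ t (suc l)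
  interval-next⊆ t {l} {x = j} j∈ = ∈interval⁺ t (suc l)
    (prev<⇒<suc n (subst (_< l) (offset-next t j) (∈interval⁻ (next t) l j∈)))

  interval-next≢ : ∀ t {l} → 1 ≤ l → l < n → interval σ t l ≢ interval σ (next t) l
  interval-next≢ t {l} 1≤l l<n eq with offset-surjective t (≤-<-trans z≤n l<n)
  ... | j₀ , offset≡0 = <⇒≱ (subst (_< l) (trans (offset-next t j₀) (cong (prev n) offset≡0)) j₀∈)
                              (m+n≤o⇒m≤o∸n _ (subst (_≤ n) (+-comm 1 _) l<n))
    where
    j₀∈ = ∈interval⁻ (next t) l (subst (j₀ ∈_) eq (∈interval⁺ t l (subst (_< l) (sym offset≡0) 1≤l)))

  interval-∁ : ∀ t {i} → i ≤ n → ∁ (interval σ t i) ≡ interval σ (rotate i t) (n ∸ i)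
  interval-∁ t {i} i≤n = trans (sym (tabulate-∘ not (λ j → offset t j <ᵇ i)))
    (tabulate-cong (λ j → AddMod-∁ (offset-< (rotate i t) j) (offset-< t j) (offset-rotate t j i≤n)))

module _ (σ : Permutation′ n) (𝓕 : Family n) where

  everyInterval-∈ : ∀ i → (∀ t t' → interval σ t i ≡ interval σ t' i) → 1 ≤ xCount 𝓕 σ i →
    ∀ t → interval σ t i ∈𝓕 𝓕
  everyInterval-∈ i same 1≤x t
    with ∑-indicator-witness (λ t → 𝓕 (interval σ t i)) (≤-trans 1≤x (xCount≤∑ 𝓕 σ i))
  ... | t₀ , t₀∈𝓕 = subst (_∈𝓕 𝓕) (same t₀ t) t₀∈𝓕

  xCount-∁ : ∀ {i} → i ≤ n → xCount 𝓕 σ (n ∸ i) ≤ ∑[ t < n ] indicator (𝓕 (∁ (interval σ t i)))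
  xCount-∁ {i} i≤n = begin
    xCount 𝓕 σ (n ∸ i)
      ≤⟨ xCount≤∑ 𝓕 σ (n ∸ i) ⟩
    ∑[ t < n ] indicator (𝓕 (interval σ t (n ∸ i)))
      ≡⟨ ∑-rotate i (λ t → indicator (𝓕 (interval σ t (n ∸ i)))) ⟨
    ∑[ t < n ] indicator (𝓕 (interval σ (rotate i t) (n ∸ i)))
      ≡⟨ sum-cong-≗ (λ t → cong (indicator ∘ 𝓕) (interval-∁ σ t i≤n)) ⟨
    ∑[ t < n ] indicator (𝓕 (∁ (interval σ t i)))
      ∎
    where open ≤-Reasoning

module _ {n : ℕ} (σ : Permutation′ n) (𝓕 : Family n) {M : ℕ} (k≤n : 3 + M ≤ n) where

  private
    K = 2 + M
    K≤n = <⇒≤ k≤n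

    card : ∀ v {l} → l ≤ K → ∣ interval σ v l ∣ ≡ l
    card v l≤K = interval-card σ v (≤-trans l≤K K≤n)

  intervals-noY : (∀ t → interval σ t 0 ∈𝓕 𝓕) → ¬ ContainsY (suc K) 𝓕 →
    ∀ t → (∀ i → 1 ≤ i → i ≤ K → interval σ (next t) i ∈𝓕 𝓕) → ¬ interval σ t K ∈𝓕 𝓕
  intervals-noY ∅∈𝓕 noY t full F₁∈𝓕 = noY (ContainsY-intro (s≤s z≤n) G F₁∈𝓕 (full K (s≤s z≤n) ≤-refl)
      (interval-next≢ σ t (s≤s z≤n) k≤n)
      (trans (card t ≤-refl) (sym (card (next t) ≤-refl)))
      level (λ i _ _ → interval-mono σ (next t) (pred[n]≤n {i}))
      (interval-next⊆ σ t) (interval-mono σ (next t) (n≤1+n (suc M))))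
    where
    G : ℕ → Subset n
    G i = interval σ (next t) (pred i)
    level-card : ∀ {j} → j ≤ K → ∣ interval σ (next t) j ∣ + (K ∸ j) ≡ ∣ interval σ t K ∣
    level-card {j} j≤K = begin
      ∣ interval σ (next t) j ∣ + (K ∸ j)  ≡⟨ cong (_+ (K ∸ j)) (card (next t) j≤K) ⟩
      j + (K ∸ j)                         ≡⟨ m+[n∸m]≡n j≤K ⟩
      K                                   ≡⟨ card t ≤-refl ⟨
      ∣ interval σ t K ∣                  ∎
      where open ≡-Reasoning
    level : ∀ i → 1 ≤ i → i ≤ K → G i ∈𝓕 𝓕 × ∣ G i ∣ + (suc K ∸ i) ≡ ∣ interval σ t K ∣
    level (suc zero)    _ _   = ∅∈𝓕 (next t) , level-card z≤n
    level (suc (suc j)) _ i≤K = full (suc j) (s≤s z≤n) (≤-trans (n≤1+n _) i≤K) , level-card (<⇒≤ i≤K)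

  intervals-noY' : ¬ ContainsY' (suc K) 𝓕 → ∀ u {G₁} →
    (∀ i → 1 ≤ i → i ≤ K → interval σ u i ∈𝓕 𝓕) → interval σ (next u) 1 ∈𝓕 𝓕 →
    ∣ G₁ ∣ ≡ suc K → interval σ u K ⊆ G₁ → ¬ G₁ ∈𝓕 𝓕
  intervals-noY' noY' u {G₁} full F₂∈𝓕 ∣G₁∣≡k uK⊆G₁ G₁∈𝓕 = noY' (ContainsY'-intro (s≤s z≤n) G
      (full 1 ≤-refl (s≤s z≤n)) F₂∈𝓕 (interval-next≢ σ u ≤-refl (≤-trans (s≤s (s≤s z≤n)) k≤n))
      (trans (card u (s≤s z≤n)) (sym (card (next u) (s≤s z≤n))))
      level G⊇G (interval-mono σ u (s≤s z≤n))
      (λ j∈ → interval-mono σ u (s≤s (m<n⇒0<n∸m (n<1+n M))) (interval-next⊆ σ u j∈)))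
    where
    G : ℕ → Subset n
    G (suc (suc j)) = interval σ u (suc (suc M ∸ j))
    G _             = G₁
    level : ∀ i → 1 ≤ i → i ≤ K → G i ∈𝓕 𝓕 × ∣ interval σ u 1 ∣ + (suc K ∸ i) ≡ ∣ G i ∣
    level (suc zero)    _ _ = G₁∈𝓕 , trans (cong (_+ K) (card u (s≤s z≤n))) (sym ∣G₁∣≡k)
    level (suc (suc j)) _ _ =
      full _ (s≤s z≤n) l≤K , trans (cong (_+ _) (card u (s≤s z≤n))) (sym (card u l≤K))
      where l≤K = s≤s (m∸n≤m (suc M) j)
    G⊇G : ∀ i → 1 ≤ i → i < K → G (suc i) ⊆ G i
    G⊇G (suc zero)    _ _ = uK⊆G₁
    G⊇G (suc (suc j)) _ _ = interval-mono σ u (s≤s (∸-monoʳ-≤ (suc M) (n≤1+n j)))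

  intervalCount : ℕ → ℕ
  intervalCount i = ∑[ t < n ] indicator (𝓕 (interval σ t i))

  interval-bound : ¬ ContainsY (suc K) 𝓕 → ¬ ContainsY' (suc K) 𝓕 → (∀ t → interval σ t 0 ∈𝓕 𝓕) →
    (y : ℕ → ℕ) → (∀ {i} → i ≤ suc K → y i ≤ intervalCount i) →
    sumRange y 1 (suc K) ≡ K * n → suc (sumRange y 1 K) ≤ K * n ∸ n / 2
  interval-bound noY noY' ∅∈𝓕 y y≤count sum≡ = m+n≤o⇒m≤o∸n (suc X) (begin
      suc X + n / 2     ≡⟨ +-suc X (n / 2) ⟨
      X + suc (n / 2)   ≤⟨ +-monoʳ-≤ X half<S ⟩
      X + S             ≤⟨ +-monoˡ-≤ S X≤C ⟩
      C + S             ≡⟨ present+missing ⟩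
      K * n             ∎)
    where
    open ≤-Reasoning
    open MissingLengths next ∑-next (s≤s (s≤s z≤n)) (λ t i → 𝓕 (interval σ t i))
    X = sumRange y 1 K
    C = sumRange intervalCount 1 K
    S = totalMissing
    X≤C : X ≤ C
    X≤C = sumRange-mono-≤ 1 K (y≤count ∘ <⇒≤)
    S≤yk : S ≤ y (suc K)
    S≤yk = +-cancelˡ-≤ X S (y (suc K)) (begin
      X + S           ≤⟨ +-monoˡ-≤ S X≤C ⟩
      C + S           ≡⟨ present+missing ⟩
      K * n           ≡⟨ sum≡ ⟨
      sumRange y 1 (suc K) ≡⟨ sumRange-snoc y 1 K ⟩
      X + y (suc K)   ∎)
    noY-intervals = intervals-noY ∅∈𝓕 noY
    long∈𝓕 : ∃ λ t → interval σ t (suc K) ∈𝓕 𝓕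
    long∈𝓕 = ∑-indicator-witness _ (≤-trans 1≤S (≤-trans S≤yk (y≤count ≤-refl)))
      where
      1≤S : 1 ≤ S
      1≤S = n≢0⇒n>0 λ S≡0 → contradiction
        (subst (λ s → 3 + M ≤ s + s) S≡0 (≤-trans k≤n (n≤2*totalMissing noY-intervals))) λ ()
    half<S : n / 2 < S
    half<S = half<totalMissing noY-intervals
      (λ t full Q₁ → intervals-noY' noY' t full Q₁ (interval-card σ t k≤n) (interval-mono σ t (n≤1+n K)))
      (λ t full Q₁ → intervals-noY' noY' (next t) full Q₁ (interval-card σ t k≤n) (interval-next⊆ σ t))
      long∈𝓕

lemma2 : (n k : ℕ) → 3 ≤ k → k ≤ n → (𝓕 : Family n)
    → ¬ ContainsY k 𝓕 → ¬ ContainsY' k 𝓕 → (σ : Permutation′ n)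
    → (xCount 𝓕 σ 0 ≡ 1
        → sumRange (xCount 𝓕 σ) 1 k ≡ (k ∸ 1) * n
        → sumRange (xCount 𝓕 σ) 0 k ≤ (k ∸ 1) * n ∸ (n / 2))
    × (xCount 𝓕 σ n ≡ 1
        → sumRange (xCount 𝓕 σ) (n ∸ k) k ≡ (k ∸ 1) * n
        → sumRange (xCount 𝓕 σ) (suc (n ∸ k)) k ≤ (k ∸ 1) * n ∸ (n / 2))
lemma2 n zero                   ()
lemma2 n (suc zero)             (s≤s ())
lemma2 n (suc (suc zero))       (s≤s (s≤s ()))
lemma2 n k@(suc K@(suc (suc M))) _ k≤n 𝓕 noY noY' σ = lower , upper
  where
  x = xCount 𝓕 σ
  lower : x 0 ≡ 1 → sumRange x 1 k ≡ K * n → sumRange x 0 k ≤ K * n ∸ n / 2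
  lower x₀≡1 sum≡ = subst (λ x₀ → x₀ + sumRange x 1 K ≤ K * n ∸ n / 2) (sym x₀≡1)
    (interval-bound σ 𝓕 k≤n noY noY' (everyInterval-∈ σ 𝓕 0 (λ _ _ → refl) (≤-reflexive (sym x₀≡1)))
                    x (λ {i} _ → xCount≤∑ 𝓕 σ i) sum≡)
  upper : x n ≡ 1 → sumRange x (n ∸ k) k ≡ K * n → sumRange x (suc (n ∸ k)) k ≤ K * n ∸ n / 2
  upper xₙ≡1 sum≡ = subst (_≤ K * n ∸ n / 2)
    (sym (trans (sumRange-top-suc x k≤n) (cong (_+ sumRange (λ i → x (n ∸ i)) 1 K) xₙ≡1)))
    (interval-bound σ (𝓕 ∘ ∁) k≤n (noY' ∘ ContainsY-∁) (noY ∘ ContainsY'-∁) ∅∈𝓕ᶜ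
                    (λ i → x (n ∸ i)) (λ i≤k → xCount-∁ σ 𝓕 (≤-trans i≤k k≤n))
                    (trans (sym (sumRange-top x k≤n)) sum≡))
    where
    full∈𝓕 : ∀ t → interval σ t n ∈𝓕 𝓕
    full∈𝓕 = everyInterval-∈ σ 𝓕 n (λ t t' → trans (sym (interval-∁ σ t z≤n)) (interval-∁ σ t' z≤n))
                                (≤-reflexive (sym xₙ≡1))
    ∅∈𝓕ᶜ : ∀ t → interval σ t 0 ∈𝓕 (𝓕 ∘ ∁)
    ∅∈𝓕ᶜ t = subst (_∈𝓕 𝓕) (sym (interval-∁ σ t z≤n)) (full∈𝓕 t)
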